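{- Let $t\ge 3$ and let $G$ be a simple undirected graph in which every vertex has degree at most $t+1$. Let $H_1$ and $H_2$ be two different $K_{t+1}$'s of $G$ with a common vertex. Then $H_1\cap H_2$ is isomorphic to $K_t$.
   Context: A "$K_{t+1}$ of $G$" is a subgraph of $G$ (not necessarily induced) isomorphic to the complete graph on $t+1$ vertices. For graphs $H_1=(V_1,E_1)$, $H_2=(V_2,E_2)$, $H_1\cap H_2$ denotes the graph $(V_1\cap V_2,E_1\cap E_2)$. $K_t$ is the complete graph on $t$ vertices. -}

module Defs where

open import Data.Nat using (ℕ; _≤_; suc)
open import Data.Bool using (Bool; true; false; _∧_)
open import Data.Fin using (Fin)
open import Data.Fin.Subset using (Subset; _∈_; _∩_; ∣_∣)
open import Data.Vec using (tabulate)
open import Data.Product using (Σ; _×_; ∃)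
open import Function using (_⇔_)
open import Function.Definitions using (Injective)
open import Relation.Binary.PropositionalEquality using (_≡_; _≢_)
open import Relation.Nullary using (¬_)

record Graph (n : ℕ) : Set where
  field
    adj    : Fin n → Fin n → Bool
    sym    : ∀ u v → adj u v ≡ adj v u
    irrefl : ∀ v → adj v v ≡ false

open Graph public

nbhd : ∀ {n} → Graph n → Fin n → Subset n
nbhd G v = tabulate (adj G v)

degree : ∀ {n} → Graph n → Fin n → ℕ
degree G v = ∣ nbhd G v ∣

-- A (not necessarily induced) simple subgraph of G: vertex set and edge set
-- (edge indicator, symmetric), edges are edges of G with endpoints in the vertex set.
record Subgraph {n : ℕ} (G : Graph n) : Set where
  field
    V       : Subset n
    E       : Fin n → Fin n → Bool
    E-sym   : ∀ u v → E u v ≡ E v u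
    E⊆G     : ∀ u v → E u v ≡ true → adj G u v ≡ true
    E-ends  : ∀ u v → E u v ≡ true → (u ∈ V) × (v ∈ V)

open Subgraph public

_∩G_ : ∀ {n} {G : Graph n} → Subgraph G → Subgraph G → Subgraph G
_∩G_ {G = G} H₁ H₂ = record
  { V      = V H₁ ∩ V H₂
  ; E      = λ u v → E H₁ u v ∧ E H₂ u v
  ; E-sym  = λ u v → eqsym u v
  ; E⊆G    = λ u v p → E⊆G H₁ u v (∧-l (E H₁ u v) p)
  ; E-ends = λ u v p → ends u v p
  }
  where
  open import Data.Bool.Properties using (∧-comm)
  open import Relation.Binary.PropositionalEquality using (cong₂; refl)
  open import Data.Fin.Subset.Properties using (x∈p∩q⁺)
  open import Data.Product using (_,_; proj₁; proj₂)
  ∧-l : ∀ a {b} → a ∧ b ≡ true → a ≡ true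
  ∧-l true  _ = refl
  ∧-l false ()
  ∧-r : ∀ a {b} → a ∧ b ≡ true → b ≡ true
  ∧-r true  p = p
  ∧-r false ()
  eqsym : ∀ u v → (E H₁ u v ∧ E H₂ u v) ≡ (E H₁ v u ∧ E H₂ v u)
  eqsym u v = cong₂ _∧_ (E-sym H₁ u v) (E-sym H₂ u v)
  ends : ∀ u v → (E H₁ u v ∧ E H₂ u v) ≡ true → (u ∈ V H₁ ∩ V H₂) × (v ∈ V H₁ ∩ V H₂)
  ends u v p with E-ends H₁ u v (∧-l (E H₁ u v) p) | E-ends H₂ u v (∧-r (E H₁ u v) p)
  ... | (a , b) | (c , d) = x∈p∩q⁺ (a , c) , x∈p∩q⁺ (b , d)

IsoToK : ∀ {n} {G : Graph n} → ℕ → Subgraph G → Set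
IsoToK {n} m H =
  Σ (Fin m → Fin n) λ f →
    Injective _≡_ _≡_ f
    × (∀ i → f i ∈ V H)
    × (∀ v → v ∈ V H → ∃ λ i → f i ≡ v)
    × (∀ i j → (E H (f i) (f j) ≡ true) ⇔ (i ≢ j))

IsK : ∀ {n} {G : Graph n} → ℕ → Subgraph G → Set
IsK m H = IsoToK m H

SameSubgraph : ∀ {n} {G : Graph n} → Subgraph G → Subgraph G → Set
SameSubgraph H₁ H₂ = (V H₁ ≡ V H₂) × (∀ u v → E H₁ u v ≡ E H₂ u v)

-- All vertices of a K_{t+1} through v lie in the closed neighbourhood of v, which has at most
-- t + 2 vertices; so two such cliques H₁, H₂ share at least 2(t + 1) − (t + 2) = t vertices.
-- They cannot share t + 1, since two complete subgraphs on the same vertex set coincide.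
-- Hence V₁ ∩ V₂ has exactly t vertices, and as a common subset of two cliques it spans a K_t.
module Submission where

open import Defs hiding (sym)
open import Data.Nat using (ℕ; _≤_; suc; _+_; s≤s)
open import Data.Nat.Properties
  using (≤-antisym; ≤-trans; ≤-reflexive; ≤-pred; ≤∧≢⇒<; <⇒≱; +-suc; +-monoˡ-≤; +-cancelˡ-≤; m≤m+n)
open import Data.Bool using (true; false)
open import Data.Fin using (Fin; zero; suc) renaming (_≟_ to _≟ᶠ_)
open import Data.Fin.Properties using (injective⇒≤; suc-injective)
open import Data.Fin.Subset using (Subset; _∈_; _⊆_; _∩_; _∪_; ∣_∣; ⁅_⁆)
open import Data.Fin.Subset.Properties
  using (_∈?_; x∈p∩q⁻; x∈p∪q⁺; x∈p∪q⁻; x∈⁅x⁆; ∣⁅x⁆∣≡1; p∩q⊆p; p∩q⊆q;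
         p⊆q⇒∣p∣≤∣q∣; p⊂q⇒∣p∣<∣q∣; ⊆-antisym; ∣p∩q∣≤∣p∣)
open import Data.Vec using ([]; _∷_; here; there; tabulate)
open import Data.Vec.Properties using (lookup⇒[]=; lookup∘tabulate)
open import Data.Product using (∃; _×_; _,_; proj₁; proj₂)
open import Data.Sum using (inj₁; inj₂)
open import Function using (Equivalence; mk⇔)
open import Function.Definitions using (Injective)
open import Relation.Binary.PropositionalEquality
open import Relation.Nullary using (¬_; yes; no; contradiction)

private
  variable
    n m : ℕ

enumerate : (S : Subset n) → Fin ∣ S ∣ → Fin n
enumerate (true  ∷ S) zero    = zero
enumerate (true  ∷ S) (suc i) = suc (enumerate S i)
enumerate (false ∷ S) i       = suc (enumerate S i)

enumerate-∈ : (S : Subset n) (i : Fin ∣ S ∣) → enumerate S i ∈ S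
enumerate-∈ (true  ∷ S) zero    = here
enumerate-∈ (true  ∷ S) (suc i) = there (enumerate-∈ S i)
enumerate-∈ (false ∷ S) i       = there (enumerate-∈ S i)

enumerate-injective : (S : Subset n) → Injective _≡_ _≡_ (enumerate S)
enumerate-injective (true  ∷ S) {zero}  {zero}  _  = refl
enumerate-injective (true  ∷ S) {suc i} {suc j} eq = cong suc (enumerate-injective S (suc-injective eq))
enumerate-injective (false ∷ S)                 eq = enumerate-injective S (suc-injective eq)

enumerate-surjective : (S : Subset n) → ∀ {x} → x ∈ S → ∃ λ i → enumerate S i ≡ x
enumerate-surjective (true  ∷ S) here      = zero , refl
enumerate-surjective (true  ∷ S) (there p) with i , eq ← enumerate-surjective S p = suc i , cong suc eq
enumerate-surjective (false ∷ S) (there p) with i , eq ← enumerate-surjective S p = i , cong suc eq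

injection⇒≤∣S∣ : (S : Subset n) (f : Fin m → Fin n) →
                 Injective _≡_ _≡_ f → (∀ i → f i ∈ S) → m ≤ ∣ S ∣
injection⇒≤∣S∣ S f f-inj f∈S = injective⇒≤ {f = index} index-injective
  where
  index : _ → Fin ∣ S ∣
  index i = proj₁ (enumerate-surjective S (f∈S i))
  index-correct : ∀ i → enumerate S (index i) ≡ f i
  index-correct i = proj₂ (enumerate-surjective S (f∈S i))
  index-injective : Injective _≡_ _≡_ index
  index-injective {i} {j} eq = f-inj (begin
    f i                     ≡⟨ sym (index-correct i) ⟩
    enumerate S (index i)   ≡⟨ cong (enumerate S) eq ⟩
    enumerate S (index j)   ≡⟨ index-correct j ⟩
    f j                     ∎)
    where open ≡-Reasoning

surjection⇒∣S∣≤ : (S : Subset n) (f : Fin m → Fin n) →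
                  (∀ {x} → x ∈ S → ∃ λ i → f i ≡ x) → ∣ S ∣ ≤ m
surjection⇒∣S∣≤ S f f-onto = injective⇒≤ {f = preimage} preimage-injective
  where
  preimage : Fin ∣ S ∣ → _
  preimage k = proj₁ (f-onto (enumerate-∈ S k))
  preimage-correct : ∀ k → f (preimage k) ≡ enumerate S k
  preimage-correct k = proj₂ (f-onto (enumerate-∈ S k))
  preimage-injective : Injective _≡_ _≡_ preimage
  preimage-injective {k} {l} eq = enumerate-injective S (begin
    enumerate S k     ≡⟨ sym (preimage-correct k) ⟩
    f (preimage k)    ≡⟨ cong f eq ⟩
    f (preimage l)    ≡⟨ preimage-correct l ⟩
    enumerate S l     ∎)
    where open ≡-Reasoning

∣p∪q∣+∣p∩q∣≡∣p∣+∣q∣ : (p q : Subset n) → ∣ p ∪ q ∣ + ∣ p ∩ q ∣ ≡ ∣ p ∣ + ∣ q ∣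
∣p∪q∣+∣p∩q∣≡∣p∣+∣q∣ []          []          = refl
∣p∪q∣+∣p∩q∣≡∣p∣+∣q∣ (true  ∷ p) (true  ∷ q) =
  cong suc (trans (+-suc _ _) (trans (cong suc (∣p∪q∣+∣p∩q∣≡∣p∣+∣q∣ p q)) (sym (+-suc _ _))))
∣p∪q∣+∣p∩q∣≡∣p∣+∣q∣ (true  ∷ p) (false ∷ q) = cong suc (∣p∪q∣+∣p∩q∣≡∣p∣+∣q∣ p q)
∣p∪q∣+∣p∩q∣≡∣p∣+∣q∣ (false ∷ p) (true  ∷ q) = trans (cong suc (∣p∪q∣+∣p∩q∣≡∣p∣+∣q∣ p q)) (sym (+-suc _ _))
∣p∪q∣+∣p∩q∣≡∣p∣+∣q∣ (false ∷ p) (false ∷ q) = ∣p∪q∣+∣p∩q∣≡∣p∣+∣q∣ p q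

∣p∪q∣≤∣p∣+∣q∣ : (p q : Subset n) → ∣ p ∪ q ∣ ≤ ∣ p ∣ + ∣ q ∣
∣p∪q∣≤∣p∣+∣q∣ p q = ≤-trans (m≤m+n _ ∣ p ∩ q ∣) (≤-reflexive (∣p∪q∣+∣p∩q∣≡∣p∣+∣q∣ p q))

p∪q⊆r⇒∣p∣+∣q∣≤∣r∣+∣p∩q∣ : {p q r : Subset n} → p ∪ q ⊆ r → ∣ p ∣ + ∣ q ∣ ≤ ∣ r ∣ + ∣ p ∩ q ∣
p∪q⊆r⇒∣p∣+∣q∣≤∣r∣+∣p∩q∣ {p = p} {q} p∪q⊆r = begin
  ∣ p ∣ + ∣ q ∣          ≡⟨ sym (∣p∪q∣+∣p∩q∣≡∣p∣+∣q∣ p q) ⟩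
  ∣ p ∪ q ∣ + ∣ p ∩ q ∣  ≤⟨ +-monoˡ-≤ ∣ p ∩ q ∣ (p⊆q⇒∣p∣≤∣q∣ p∪q⊆r) ⟩
  _                      ∎
  where open Data.Nat.Properties.≤-Reasoning

p⊆q∧∣q∣≤∣p∣⇒p≡q : {p q : Subset n} → p ⊆ q → ∣ q ∣ ≤ ∣ p ∣ → p ≡ q
p⊆q∧∣q∣≤∣p∣⇒p≡q {p = p} {q} p⊆q ∣q∣≤∣p∣ = ⊆-antisym p⊆q q⊆p
  where
  q⊆p : q ⊆ p
  q⊆p {x} x∈q with x ∈? p
  ... | yes x∈p = x∈p
  ... | no  x∉p = contradiction ∣q∣≤∣p∣ (<⇒≱ (p⊂q⇒∣p∣<∣q∣ (p⊆q , x , x∈q , x∉p)))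

closedNbhd : Graph n → Fin n → Subset n
closedNbhd G v = ⁅ v ⁆ ∪ nbhd G v

∣closedNbhd∣≤1+degree : (G : Graph n) (v : Fin n) → ∣ closedNbhd G v ∣ ≤ suc (degree G v)
∣closedNbhd∣≤1+degree G v = ≤-trans (∣p∪q∣≤∣p∣+∣q∣ ⁅ v ⁆ (nbhd G v))
                                    (≤-reflexive (cong (_+ degree G v) (∣⁅x⁆∣≡1 v)))

module _ {G : Graph n} where

  IsClique : Subgraph G → Set
  IsClique H = ∀ {u w} → u ∈ V H → w ∈ V H → u ≢ w → E H u w ≡ true

  edge⇒≢ : (H : Subgraph G) → ∀ {u w} → E H u w ≡ true → u ≢ w
  edge⇒≢ H {u} uw refl with () ← trans (sym (E⊆G H u u uw)) (irrefl G u)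

  IsoToK⇒∣V∣≡ : (H : Subgraph G) → IsoToK m H → ∣ V H ∣ ≡ m
  IsoToK⇒∣V∣≡ H (f , f-inj , f∈V , f-onto , _) =
    ≤-antisym (surjection⇒∣S∣≤ (V H) f (f-onto _)) (injection⇒≤∣S∣ (V H) f f-inj f∈V)

  IsoToK⇒IsClique : (H : Subgraph G) → IsoToK m H → IsClique H
  IsoToK⇒IsClique H (f , _ , _ , f-onto , f-edges) {u} {w} u∈V w∈V u≢w
    with i , refl ← f-onto u u∈V | j , refl ← f-onto w w∈V =
    Equivalence.from (f-edges i j) (λ i≡j → u≢w (cong f i≡j))

  IsClique⇒IsoToK : (H : Subgraph G) → IsClique H → ∣ V H ∣ ≡ m → IsoToK m H
  IsClique⇒IsoToK H clique refl =
    enumerate (V H) , enumerate-injective (V H) , enumerate-∈ (V H) ,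
    (λ _ → enumerate-surjective (V H)) ,
    λ i j → mk⇔ (λ e i≡j → edge⇒≢ H e (cong (enumerate (V H)) i≡j))
                (λ i≢j → clique (enumerate-∈ (V H) i) (enumerate-∈ (V H) j)
                                (λ eq → i≢j (enumerate-injective (V H) eq)))

  IsClique-∩G : (H₁ H₂ : Subgraph G) → IsClique H₁ → IsClique H₂ → IsClique (H₁ ∩G H₂)
  IsClique-∩G H₁ H₂ clique₁ clique₂ u∈V w∈V u≢w
    with u∈V₁ , u∈V₂ ← x∈p∩q⁻ (V H₁) (V H₂) u∈V | w∈V₁ , w∈V₂ ← x∈p∩q⁻ (V H₁) (V H₂) w∈V
    rewrite clique₁ u∈V₁ w∈V₁ u≢w | clique₂ u∈V₂ w∈V₂ u≢w = refl

  cliques-on-same-vertices : (H₁ H₂ : Subgraph G) → IsClique H₁ → IsClique H₂ →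
                             V H₁ ≡ V H₂ → SameSubgraph H₁ H₂
  cliques-on-same-vertices H₁ H₂ clique₁ clique₂ V₁≡V₂ = V₁≡V₂ , same-edges
    where
    V₁⊆V₂ : V H₁ ⊆ V H₂
    V₁⊆V₂ = subst (_ ∈_) V₁≡V₂
    V₂⊆V₁ : V H₂ ⊆ V H₁
    V₂⊆V₁ = subst (_ ∈_) (sym V₁≡V₂)
    same-edges : ∀ u w → E H₁ u w ≡ E H₂ u w
    same-edges u w with E H₁ u w in e₁ | E H₂ u w in e₂
    ... | true  | true  = refl
    ... | false | false = refl
    ... | true  | false with u∈V₁ , w∈V₁ ← E-ends H₁ u w e₁
      with () ← trans (sym e₂) (clique₂ (V₁⊆V₂ u∈V₁) (V₁⊆V₂ w∈V₁) (edge⇒≢ H₁ e₁))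
    ... | false | true  with u∈V₂ , w∈V₂ ← E-ends H₂ u w e₂
      with () ← trans (sym e₁) (clique₁ (V₂⊆V₁ u∈V₂) (V₂⊆V₁ w∈V₂) (edge⇒≢ H₂ e₂))

  clique⊆closedNbhd : (H : Subgraph G) → IsClique H → ∀ {v} → v ∈ V H → V H ⊆ closedNbhd G v
  clique⊆closedNbhd H clique {v} v∈V {x} x∈V with x ≟ᶠ v
  ... | yes refl = x∈p∪q⁺ (inj₁ (x∈⁅x⁆ x))
  ... | no  x≢v  = x∈p∪q⁺ (inj₂ (lookup⇒[]= x (tabulate (adj G v))
                     (trans (lookup∘tabulate (adj G v) x)
                            (E⊆G H v x (clique v∈V x∈V (λ v≡x → x≢v (sym v≡x)))))))

  cliques⊆closedNbhd : (H₁ H₂ : Subgraph G) → IsClique H₁ → IsClique H₂ →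
                       ∀ {v} → v ∈ V H₁ → v ∈ V H₂ → V H₁ ∪ V H₂ ⊆ closedNbhd G v
  cliques⊆closedNbhd H₁ H₂ clique₁ clique₂ v∈V₁ v∈V₂ x∈V₁∪V₂ with x∈p∪q⁻ (V H₁) (V H₂) x∈V₁∪V₂
  ... | inj₁ x∈V₁ = clique⊆closedNbhd H₁ clique₁ v∈V₁ x∈V₁
  ... | inj₂ x∈V₂ = clique⊆closedNbhd H₂ clique₂ v∈V₂ x∈V₂

lemma1 : (t n : ℕ) → 3 ≤ t → (G : Graph n)
    → (∀ v → degree G v ≤ suc t)
    → (H₁ H₂ : Subgraph G) → IsK (suc t) H₁ → IsK (suc t) H₂
    → ¬ SameSubgraph H₁ H₂
    → (∃ λ v → (v ∈ V H₁) × (v ∈ V H₂))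
    → IsoToK t (H₁ ∩G H₂)
lemma1 t n _ G deg≤ H₁ H₂ K₁ K₂ H₁≠H₂ (v , v∈V₁ , v∈V₂) =
  IsClique⇒IsoToK (H₁ ∩G H₂) (IsClique-∩G H₁ H₂ clique₁ clique₂) (≤-antisym upper lower)
  where
  clique₁ : IsClique H₁
  clique₁ = IsoToK⇒IsClique H₁ K₁
  clique₂ : IsClique H₂
  clique₂ = IsoToK⇒IsClique H₂ K₂
  ∣V₁∣≡ : ∣ V H₁ ∣ ≡ suc t
  ∣V₁∣≡ = IsoToK⇒∣V∣≡ H₁ K₁
  ∣V₂∣≡ : ∣ V H₂ ∣ ≡ suc t
  ∣V₂∣≡ = IsoToK⇒∣V∣≡ H₂ K₂

  lower : t ≤ ∣ V H₁ ∩ V H₂ ∣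
  lower = +-cancelˡ-≤ (suc (suc t)) t _ (begin
    suc (suc t) + t                        ≡⟨ cong suc (sym (+-suc t t)) ⟩
    suc t + suc t                          ≡⟨ sym (cong₂ _+_ ∣V₁∣≡ ∣V₂∣≡) ⟩
    ∣ V H₁ ∣ + ∣ V H₂ ∣                    ≤⟨ p∪q⊆r⇒∣p∣+∣q∣≤∣r∣+∣p∩q∣
                                                (cliques⊆closedNbhd H₁ H₂ clique₁ clique₂ v∈V₁ v∈V₂) ⟩
    ∣ closedNbhd G v ∣ + ∣ V H₁ ∩ V H₂ ∣   ≤⟨ +-monoˡ-≤ _ (≤-trans (∣closedNbhd∣≤1+degree G v) (s≤s (deg≤ v))) ⟩
    suc (suc t) + ∣ V H₁ ∩ V H₂ ∣          ∎)
    where open Data.Nat.Properties.≤-Reasoning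

  ∣V₁∩V₂∣≢1+t : ∣ V H₁ ∩ V H₂ ∣ ≢ suc t
  ∣V₁∩V₂∣≢1+t ∣∩∣≡ = H₁≠H₂ (cliques-on-same-vertices H₁ H₂ clique₁ clique₂ (begin
    V H₁            ≡⟨ sym (p⊆q∧∣q∣≤∣p∣⇒p≡q (p∩q⊆p (V H₁) (V H₂)) (≤-reflexive (trans ∣V₁∣≡ (sym ∣∩∣≡)))) ⟩
    V H₁ ∩ V H₂     ≡⟨ p⊆q∧∣q∣≤∣p∣⇒p≡q (p∩q⊆q (V H₁) (V H₂)) (≤-reflexive (trans ∣V₂∣≡ (sym ∣∩∣≡))) ⟩
    V H₂            ∎))
    where open ≡-Reasoning

  upper : ∣ V H₁ ∩ V H₂ ∣ ≤ t
  upper = ≤-pred (≤∧≢⇒< (≤-trans (∣p∩q∣≤∣p∣ (V H₁) (V H₂)) (≤-reflexive ∣V₁∣≡)) ∣V₁∩V₂∣≢1+t)
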